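{- Let $m\geq 2$ and $n\geq 3$ be integers with $m\leq n$, and let $m_0=\max\{k\in\mathbb{N} : k(k-1)-1\leq n\}$. (a) If $m\leq m_0-1$, then $\chi_L(K_m\square K_n)=n+1$. (b) If $m_0+1\leq m\leq \frac{n}{2}$, then $\chi_L(K_m\square K_n)=n+2$.
   Context: $K_k$ is the complete graph on $k$ vertices and $\square$ the cartesian product: $V(G\square H)=V(G)\times V(H)$, with $(a,b)\sim(a',b')$ iff ($a=a'$ and $bb'\in E(H)$) or ($aa'\in E(G)$ and $b=b'$). For a connected graph $G$, with $d$ the shortest-path distance and $d(v,S)=\min_{x\in S}d(v,x)$, a proper $k$-coloring (onto $\{1,\dots,k\}$) with ordered color classes $(V_1,\dots,V_k)$ is a locating coloring if distinct vertices $v$ have distinct color codes $(d(v,V_1),\dots,d(v,V_k))$; $\chi_L(G)$ is the minimum $k$ for which a locating $k$-coloring exists. -}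

module Defs where

open import Level using (0ℓ)
open import Data.Nat using (ℕ; zero; suc; _+_; _*_; _∸_; _≤_; _<_)
open import Data.Fin using (Fin)
open import Data.Product using (Σ; ∃; _×_; _,_)
open import Data.Sum using (_⊎_)
open import Relation.Nullary using (¬_)
open import Relation.Binary.PropositionalEquality using (_≡_; _≢_)

record Graph : Set₁ where
  field
    V   : Set
    Adj : V → V → Set
open Graph public

K : ℕ → Graph
K k = record { V = Fin k ; Adj = λ a b → a ≢ b }

_□_ : Graph → Graph → Graph
G □ H = record
  { V   = V G × V H
  ; Adj = λ { (a , b) (a' , b') →
              (a ≡ a' × Adj H b b') ⊎ (Adj G a a' × b ≡ b') } }

data Walk (G : Graph) : V G → V G → ℕ → Set where
  here : ∀ {u} → Walk G u u zero
  step : ∀ {u w v k} → Adj G u w → Walk G w v k → Walk G u v (suc k)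

Dist : (G : Graph) → V G → V G → ℕ → Set
Dist G u v k = Walk G u v k × (∀ j → j < k → ¬ Walk G u v j)

SetDist : (G : Graph) → V G → (V G → Set) → ℕ → Set
SetDist G v S k =
  (Σ (V G) λ x → S x × Dist G v x k) ×
  (∀ x j → S x → Dist G v x j → k ≤ j)

IsProperColoring : (G : Graph) (k : ℕ) → (V G → Fin k) → Set
IsProperColoring G k c = ∀ u v → Adj G u v → c u ≢ c v

IsOnto : (G : Graph) (k : ℕ) → (V G → Fin k) → Set
IsOnto G k c = ∀ i → Σ (V G) λ v → c v ≡ i

ColorClass : (G : Graph) (k : ℕ) → (V G → Fin k) → Fin k → V G → Set
ColorClass G k c i x = c x ≡ i

SameCode : (G : Graph) (k : ℕ) → (V G → Fin k) → V G → V G → Set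
SameCode G k c u v =
  ∀ i j j' → SetDist G u (ColorClass G k c i) j
           → SetDist G v (ColorClass G k c i) j' → j ≡ j'

IsLocatingColoring : (G : Graph) (k : ℕ) → (V G → Fin k) → Set
IsLocatingColoring G k c =
  IsProperColoring G k c × IsOnto G k c ×
  (∀ u v → SameCode G k c u v → u ≡ v)

LocColorable : Graph → ℕ → Set
LocColorable G k = Σ (V G → Fin k) λ c → IsLocatingColoring G k c

χL≡ : Graph → ℕ → Set
χL≡ G t = LocColorable G t × (∀ k → LocColorable G k → t ≤ k)

-- k(k-1) - 1 ≤ n  (over ℤ), i.e. k(k-1) ≤ n + 1
M0Cond : ℕ → ℕ → Set
M0Cond n k = k * (k ∸ 1) ≤ suc n

IsM0 : ℕ → ℕ → Set
IsM0 n m0 = M0Cond n m0 × (∀ k → M0Cond n k → k ≤ m0)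

-- K m □ K n has diameter two, so the colour code of a vertex records only its colour and which
-- colours occur in its row or column. A row holds n distinct colours, so at least n + 1 colours
-- are needed, and with exactly n + 1 colours each row misses exactly one colour; two vertices of
-- different rows then share their code only if they have the same colour and both see every
-- colour ("flags"). When 2m ≤ n the missing colours of distinct rows are distinct, which yields
-- m(m − 1) flags that need distinct colours, so m(m − 1) ≤ n + 1, i.e. m ≤ m0. For m > m0 the
-- colouring b + 2a + 2 mod n + 2 shows that n + 2 colours suffice; for m < m0 an explicit
-- (n + 1)-colouring, in which row a misses a special colour of its own and the flags receive
-- distinct ordinary colours, shows that n + 1 suffice.
module Submission where

open import Defs
open import Data.Nat using (ℕ; zero; suc; _+_; _*_; _∸_; _≤_; _<_; z≤n; s≤s; _<?_; NonZero)
open import Data.Nat.Properties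
open import Data.Nat.DivMod using (_%_; [m+kn]%n≡m%n; m<n⇒m%n≡m)
open import Data.Nat.Tactic.RingSolver using (solve-∀)
open import Data.Fin using (Fin; zero; suc; toℕ; fromℕ<; punchIn; punchOut; splitAt; join) renaming (_≟_ to _≟ᶠ_)
import Data.Fin.Properties as FinP
open import Data.Product using (Σ; ∃; _×_; _,_; proj₁; proj₂)
open import Data.Product.Properties using (,-injective)
open import Data.Sum using (_⊎_; inj₁; inj₂; [_,_])
open import Data.Sum.Properties using (inj₁-injective; inj₂-injective)
open import Data.Sum.Function.Propositional using (_⊎-↔_)
open import Data.Empty using (⊥; ⊥-elim)
open import Function using (_∘_; id; _↔_; Injection)
open import Function.Definitions using (Injective)
open import Function.Properties.Inverse using (↔-refl; ↔-sym; ↔-trans; ↔⇒↣)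
open import Relation.Nullary using (¬_; Dec; yes; no; contradiction)
open import Relation.Nullary.Decidable using (_⊎-dec_)
open import Relation.Binary.PropositionalEquality hiding ([_])
open import Relation.Binary.Definitions using (tri<; tri≈; tri>)

≤-viaInjection : {A B : Set} {p q : ℕ} → A ↔ Fin p → B ↔ Fin q →
                 (f : A → B) → Injective _≡_ _≡_ f → p ≤ q
≤-viaInjection A↔ B↔ f f-inj =
  FinP.injective⇒≤ (λ e → Injection.injective (↔⇒↣ (↔-sym A↔)) (f-inj (Injection.injective (↔⇒↣ B↔) e)))

<-viaInjectionAvoiding : ∀ {p q} (f : Fin p → Fin q) → Injective _≡_ _≡_ f →
                         (x : Fin q) → (∀ i → f i ≢ x) → p < q
<-viaInjectionAvoiding {p} {q} f f-inj x f≢x = FinP.injective⇒≤ g-inj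
  where
  g : Fin (suc p) → Fin q
  g zero    = x
  g (suc i) = f i
  g-inj : Injective _≡_ _≡_ g
  g-inj {zero}  {zero}  _ = refl
  g-inj {zero}  {suc j} e = contradiction (sym e) (f≢x j)
  g-inj {suc i} {zero}  e = contradiction e (f≢x i)
  g-inj {suc i} {suc j} e = cong suc (f-inj e)

punchOut₂ : ∀ {n} {a a' i : Fin (suc (suc n))} → a ≢ a' → a ≢ i → a' ≢ i → Fin n
punchOut₂ a≢a' a≢i a'≢i = punchOut (a'≢i ∘ FinP.punchOut-injective a≢a' a≢i)

punchOut₂-injective : ∀ {n} {a a' i i' : Fin (suc (suc n))} (a≢a' : a ≢ a')
                      (a≢i : a ≢ i) (a'≢i : a' ≢ i) (a≢i' : a ≢ i') (a'≢i' : a' ≢ i') →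
                      punchOut₂ a≢a' a≢i a'≢i ≡ punchOut₂ a≢a' a≢i' a'≢i' → i ≡ i'
punchOut₂-injective a≢a' a≢i _ a≢i' _ e =
  FinP.punchOut-injective a≢i a≢i' (FinP.punchOut-injective {i = punchOut a≢a'} _ _ e)

-- Colour codes in K m □ K n

module Rook (m n : ℕ) where

  Vertex : Set
  Vertex = Fin m × Fin n

  G : Graph
  G = K m □ K n

  adj⇒≢ : ∀ {u v : Vertex} → Adj G u v → u ≢ v
  adj⇒≢ (inj₁ (_ , b≢b')) refl = b≢b' refl
  adj⇒≢ (inj₂ (a≢a' , _)) refl = a≢a' refl

  walk₀⇒≡ : ∀ {u v} → Walk G u v 0 → u ≡ v
  walk₀⇒≡ here = refl

  walk₁⇒adj : ∀ {u v} → Walk G u v 1 → Adj G u v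
  walk₁⇒adj (step uv here) = uv

  ≡⊎adj⊎walk₂ : ∀ (u v : Vertex) → u ≡ v ⊎ Adj G u v ⊎ Walk G u v 2
  ≡⊎adj⊎walk₂ (a , b) (a' , b') with a ≟ᶠ a' | b ≟ᶠ b'
  ... | yes refl | yes refl = inj₁ refl
  ... | yes refl | no b≢b'  = inj₂ (inj₁ (inj₁ (refl , b≢b')))
  ... | no a≢a'  | yes refl = inj₂ (inj₁ (inj₂ (a≢a' , refl)))
  ... | no a≢a'  | no b≢b'  = inj₂ (inj₂ (step (inj₁ (refl , b≢b')) (step (inj₂ (a≢a' , refl)) here)))

  setDist-unique : ∀ {v S j j'} → SetDist G v S j → SetDist G v S j' → j ≡ j'
  setDist-unique ((x , x∈S , dx) , min) ((x' , x'∈S , dx') , min') =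
    ≤-antisym (min x' _ x'∈S dx') (min' x _ x∈S dx)

  module Colouring (k : ℕ) (c : Vertex → Fin k) where

    InRow : Fin m → Fin k → Set
    InRow a x = ∃ λ j → c (a , j) ≡ x

    InCol : Fin n → Fin k → Set
    InCol b x = ∃ λ i → c (i , b) ≡ x

    -- The colours at distance at most one from (a , b); by setDist₀, setDist₁ and setDist₂ the
    -- colour code of a vertex is determined by its colour and these.
    Near : Vertex → Fin k → Set
    Near (a , b) x = InRow a x ⊎ InCol b x

    InRow? : ∀ a x → Dec (InRow a x)
    InRow? a x = FinP.any? (λ j → c (a , j) ≟ᶠ x)

    InCol? : ∀ b x → Dec (InCol b x)
    InCol? b x = FinP.any? (λ i → c (i , b) ≟ᶠ x)

    Near? : ∀ u x → Dec (Near u x)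
    Near? (a , b) x = InRow? a x ⊎-dec InCol? b x

    near-own : ∀ u → Near u (c u)
    near-own (a , b) = inj₁ (b , refl)

    adj⇒near : ∀ {u v x} → Adj G u v → c v ≡ x → Near u x
    adj⇒near {v = _ , b'} (inj₁ (refl , _)) e = inj₁ (b' , e)
    adj⇒near {v = a' , _} (inj₂ (_ , refl)) e = inj₂ (a' , e)

    near⇒adj : ∀ {u x} → c u ≢ x → Near u x → ∃ λ v → Adj G u v × c v ≡ x
    near⇒adj {a , b} cu≢x (inj₁ (j , e)) with b ≟ᶠ j
    ... | yes refl = contradiction e cu≢x
    ... | no b≢j   = (a , j) , inj₁ (refl , b≢j) , e
    near⇒adj {a , b} cu≢x (inj₂ (i , e)) with a ≟ᶠ i
    ... | yes refl = contradiction e cu≢x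
    ... | no a≢i   = (i , b) , inj₂ (a≢i , refl) , e

    Class : Fin k → Vertex → Set
    Class = ColorClass G k c

    setDist₀ : ∀ {u x} → c u ≡ x → SetDist G u (Class x) 0
    setDist₀ {u} cu≡x = (u , cu≡x , here , λ _ ()) , λ _ _ _ _ → z≤n

    setDist₁ : ∀ {u x} → c u ≢ x → Near u x → SetDist G u (Class x) 1
    setDist₁ {u} {x} cu≢x near with near⇒adj cu≢x near
    ... | v , uv , cv≡x = (v , cv≡x , step uv here , shorter) , minimal
      where
      shorter : ∀ j → j < 1 → ¬ Walk G u v j
      shorter zero _ w = adj⇒≢ uv (walk₀⇒≡ w)
      shorter (suc j) (s≤s ()) _
      minimal : ∀ y j → Class x y → Dist G u y j → 1 ≤ j
      minimal y zero    cy≡x (w , _) = contradiction (subst (λ z → c z ≡ x) (sym (walk₀⇒≡ w)) cy≡x) cu≢x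
      minimal y (suc j) _      _     = s≤s z≤n

    setDist₂ : ∀ {u x} → (∃ λ v → c v ≡ x) → ¬ Near u x → SetDist G u (Class x) 2
    setDist₂ {u} {x} (v , cv≡x) far = (v , cv≡x , walk , shorter) , minimal
      where
      ≢u : ∀ {y} → Class x y → u ≢ y
      ≢u cy≡x refl = far (subst (Near u) cy≡x (near-own u))
      ¬adj : ∀ {y} → Class x y → ¬ Adj G u y
      ¬adj cy≡x uy = far (adj⇒near uy cy≡x)
      walk : Walk G u v 2
      walk with ≡⊎adj⊎walk₂ u v
      ... | inj₁ u≡v        = contradiction u≡v (≢u cv≡x)
      ... | inj₂ (inj₁ uv)  = contradiction uv (¬adj cv≡x)
      ... | inj₂ (inj₂ w)   = w
      shorter : ∀ j → j < 2 → ¬ Walk G u v j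
      shorter zero       _ w = ≢u cv≡x (walk₀⇒≡ w)
      shorter (suc zero) _ w = ¬adj cv≡x (walk₁⇒adj w)
      shorter (suc (suc j)) (s≤s (s≤s ())) _
      minimal : ∀ y j → Class x y → Dist G u y j → 2 ≤ j
      minimal y zero             cy≡x (w , _) = contradiction (walk₀⇒≡ w) (≢u cy≡x)
      minimal y (suc zero)       cy≡x (w , _) = contradiction (walk₁⇒adj w) (¬adj cy≡x)
      minimal y (suc (suc j))    _    _       = s≤s (s≤s z≤n)

    Locating : Set
    Locating = ∀ u v → SameCode G k c u v → u ≡ v

    NearLocating : Set
    NearLocating = ∀ u v → c u ≡ c v → (∀ x → Near u x → Near v x) → (∀ x → Near v x → Near u x) → u ≡ v

    module Onto (onto : IsOnto G k c) where

      sameCode⇒near : ∀ {u v} → SameCode G k c u v → ∀ x → Near u x → Near v x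
      sameCode⇒near {u} {v} same x near-u with Near? v x | c u ≟ᶠ x
      ... | yes near-v | _        = near-v
      ... | no far-v   | yes cu≡x = contradiction (same x 0 2 (setDist₀ cu≡x) (setDist₂ (onto x) far-v)) 0≢1+n
      ... | no far-v   | no cu≢x  =
        contradiction (same x 1 2 (setDist₁ cu≢x near-u) (setDist₂ (onto x) far-v)) (0≢1+n ∘ suc-injective)

      sameCode-sym : ∀ {u v} → SameCode G k c u v → SameCode G k c v u
      sameCode-sym same x j j' d d' = sym (same x j' j d' d)

      sameCode⇒sameColour : ∀ {u v} → SameCode G k c u v → c u ≡ c v
      sameCode⇒sameColour {u} {v} same with c v ≟ᶠ c u
      ... | yes cv≡cu = sym cv≡cu
      ... | no cv≢cu  = contradiction (same (c u) 0 1 (setDist₀ refl) (setDist₁ cv≢cu (sameCode⇒near same (c u) (near-own u)))) 0≢1+n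

      sameNear⇒sameCode : ∀ {u v} → c u ≡ c v → (∀ x → Near u x → Near v x) → (∀ x → Near v x → Near u x) →
                          SameCode G k c u v
      sameNear⇒sameCode {u} {v} cu≡cv u⇒v v⇒u x j j' du dv with c u ≟ᶠ x | Near? u x
      ... | yes cu≡x | _ = trans (setDist-unique du (setDist₀ cu≡x)) (setDist-unique (setDist₀ (trans (sym cu≡cv) cu≡x)) dv)
      ... | no cu≢x | yes near-u = trans (setDist-unique du (setDist₁ cu≢x near-u))
                                         (setDist-unique (setDist₁ (cu≢x ∘ trans cu≡cv) (u⇒v x near-u)) dv)
      ... | no cu≢x | no far-u = trans (setDist-unique du (setDist₂ (onto x) far-u))
                                       (setDist-unique (setDist₂ (onto x) (far-u ∘ v⇒u x)) dv)

      nearLocating⇒locating : NearLocating → Locating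
      nearLocating⇒locating loc u v same =
        loc u v (sameCode⇒sameColour same) (sameCode⇒near same) (sameCode⇒near (sameCode-sym same))

      locating⇒nearLocating : Locating → NearLocating
      locating⇒nearLocating loc u v cu≡cv u⇒v v⇒u = loc u v (sameNear⇒sameCode cu≡cv u⇒v v⇒u)

    module Proper (proper : IsProperColoring G k c) where

      row-injective : ∀ a → Injective _≡_ _≡_ (λ j → c (a , j))
      row-injective a {j} {j'} e with j ≟ᶠ j'
      ... | yes j≡j' = j≡j'
      ... | no j≢j'  = contradiction e (proper (a , j) (a , j') (inj₁ (refl , j≢j')))

      col-injective : ∀ b → Injective _≡_ _≡_ (λ i → c (i , b))
      col-injective b {i} {i'} e with i ≟ᶠ i'
      ... | yes i≡i' = i≡i'
      ... | no i≢i'  = contradiction e (proper (i , b) (i' , b) (inj₂ (i≢i' , refl)))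

      missing⇒< : ∀ {a x} → ¬ InRow a x → n < k
      missing⇒< {a} {x} miss = <-viaInjectionAvoiding (λ j → c (a , j)) (row-injective a) x (λ j e → miss (j , e))

      full⊎missing : ∀ a → (∀ x → InRow a x) ⊎ ∃ λ x → ¬ InRow a x
      full⊎missing a with FinP.all? (InRow? a)
      ... | yes full = inj₁ full
      ... | no ¬full = inj₂ (FinP.¬∀⟶∃¬ k (InRow a) (InRow? a) ¬full)

      -- Two full rows would contain two vertices that see every colour and share one.
      locating⇒n<colours : {a₀ a₁ : Fin m} → a₀ ≢ a₁ → Fin n → IsOnto G k c → Locating → n < k
      locating⇒n<colours {a₀} {a₁} a₀≢a₁ j₀ onto loc with full⊎missing a₀ | full⊎missing a₁
      ... | inj₂ (_ , miss) | _               = missing⇒< miss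
      ... | inj₁ _          | inj₂ (_ , miss) = missing⇒< miss
      ... | inj₁ full₀      | inj₁ full₁      = contradiction (cong proj₁ same) a₀≢a₁
        where
        open Onto onto
        j₁ : Fin n
        j₁ = proj₁ (full₁ (c (a₀ , j₀)))
        same : (a₀ , j₀) ≡ (a₁ , j₁)
        same = locating⇒nearLocating loc _ _ (sym (proj₂ (full₁ (c (a₀ , j₀)))))
                 (λ x _ → inj₁ (full₁ x)) (λ x _ → inj₁ (full₀ x))

module OneSpareColour {m n : ℕ} (c : Fin m × Fin n → Fin (suc n)) (proper : IsProperColoring (K m □ K n) (suc n) c) where
  open Rook m n
  open Colouring (suc n) c
  open Proper proper

  missing-unique : ∀ {a x y} → ¬ InRow a x → ¬ InRow a y → x ≡ y
  missing-unique {a} {x} {y} miss-x miss-y with x ≟ᶠ y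
  ... | yes x≡y = x≡y
  ... | no x≢y  = contradiction (<-viaInjectionAvoiding shifted shifted-inj (punchOut x≢y) avoids) (<-irrefl refl)
    where
    shifted : Fin n → Fin n
    shifted j = punchOut {i = x} {j = c (a , j)} (λ e → miss-x (j , sym e))
    shifted-inj : Injective _≡_ _≡_ shifted
    shifted-inj e = row-injective a (FinP.punchOut-injective {i = x} _ _ e)
    avoids : ∀ j → shifted j ≢ punchOut x≢y
    avoids j e = miss-y (j , FinP.punchOut-injective {i = x} _ _ e)

  inRow-unless-missing : ∀ {a x y} → ¬ InRow a x → y ≢ x → InRow a y
  inRow-unless-missing {a} {x} {y} miss-x y≢x with InRow? a y
  ... | yes in-y  = in-y
  ... | no miss-y = contradiction (missing-unique miss-y miss-x) y≢x

  missing : ∀ a → ∃ λ x → ¬ InRow a x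
  missing a with full⊎missing a
  ... | inj₂ miss = miss
  ... | inj₁ full = contradiction (FinP.injective⇒≤ position-inj) 1+n≰n
    where
    position : Fin (suc n) → Fin n
    position x = proj₁ (full x)
    position-inj : Injective _≡_ _≡_ position
    position-inj {x} {y} e = trans (sym (proj₂ (full x))) (trans (cong (λ j → c (a , j)) e) (proj₂ (full y)))

  module Missing (r : Fin m → Fin (suc n)) (r-missing : ∀ a → ¬ InRow a (r a))
                 (r-injective : Injective _≡_ _≡_ r) where

    Flag : Vertex → Set
    Flag (a , b) = InCol b (r a)

    inRow-other : ∀ {a a'} → a ≢ a' → InRow a' (r a)
    inRow-other a≢a' = inRow-unless-missing (r-missing _) (a≢a' ∘ r-injective)

    onto : {a₀ a₁ : Fin m} → a₀ ≢ a₁ → IsOnto G (suc n) c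
    onto {a₀} {a₁} a₀≢a₁ x with x ≟ᶠ r a₀
    ... | yes refl  = let (j , e) = inRow-other a₀≢a₁ in (a₁ , j) , e
    ... | no x≢r₀   = let (j , e) = inRow-unless-missing (r-missing a₀) x≢r₀ in (a₀ , j) , e

    flag⇒near : ∀ {u} → Flag u → ∀ x → Near u x
    flag⇒near {a , b} flag x with x ≟ᶠ r a
    ... | yes refl = inj₂ flag
    ... | no x≢r   = inj₁ (inRow-unless-missing (r-missing a) x≢r)

    near⇒flag : ∀ {a b} → Near (a , b) (r a) → Flag (a , b)
    near⇒flag {a} (inj₁ in-row) = contradiction in-row (r-missing a)
    near⇒flag     (inj₂ flag)   = flag

    nearLocating⇒flags-injective : NearLocating → ∀ {u v} → Flag u → Flag v → c u ≡ c v → u ≡ v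
    nearLocating⇒flags-injective loc {u} {v} flag-u flag-v cu≡cv =
      loc u v cu≡cv (λ x _ → flag⇒near flag-v x) (λ x _ → flag⇒near flag-u x)

    -- Two vertices of different rows that see the same colours see all of them, so both are flags.
    flags-injective⇒nearLocating : (∀ {a b a' b'} → Flag (a , b) → Flag (a' , b') → c (a , b) ≡ c (a' , b') → a ≡ a') →
                                   NearLocating
    flags-injective⇒nearLocating flags-inj (a , b) (a' , b') cu≡cv u⇒v v⇒u with a ≟ᶠ a'
    ... | yes refl = cong (a ,_) (row-injective a cu≡cv)
    ... | no a≢a'  = contradiction (flags-inj flag-u flag-v cu≡cv) a≢a'
      where
      flag-u : Flag (a , b)
      flag-u = near⇒flag (v⇒u (r a) (inj₁ (inRow-other a≢a')))
      flag-v : Flag (a' , b')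
      flag-v = near⇒flag (u⇒v (r a') (inj₁ (inRow-other (a≢a' ∘ sym))))

2[2+m]≤n⇒2n≰n+2m : ∀ m n → 2 * (2 + m) ≤ n → ¬ (2 * n ≤ n + 2 * m)
2[2+m]≤n⇒2n≰n+2m m n 2[2+m]≤n 2n≤n+2m = <-irrefl refl (begin-strict
  2 * m       <⟨ *-monoʳ-< 2 (m<n+m m {2} (s≤s z≤n)) ⟩
  2 * (2 + m) ≤⟨ 2[2+m]≤n ⟩
  n           ≡⟨ +-identityʳ n ⟨
  n + 0       ≤⟨ +-cancelˡ-≤ n (n + 0) (2 * m) 2n≤n+2m ⟩
  2 * m       ∎)
  where open ≤-Reasoning

module _ {m'' n : ℕ} {c : Fin (2 + m'') × Fin n → Fin (suc n)}
         (proper : IsProperColoring (K (2 + m'') □ K n) (suc n) c) where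
  open Rook (2 + m'') n
  open Colouring (suc n) c
  open Proper proper
  open OneSpareColour c proper

  -- If rows a ≠ a' both miss ρ, their 2n cells are coded injectively: a cell whose column contains ρ
  -- by its row and the row of that ρ (one of the other m − 2); any other cell sees every colour but
  -- ρ, so it is located by its own colour. Hence 2n ≤ n + 2(m − 2).
  missing-injective : NearLocating → 2 * (2 + m'') ≤ n →
                      ∀ {a a' ρ} → ¬ InRow a ρ → ¬ InRow a' ρ → a ≡ a'
  missing-injective loc 2m≤n {a} {a'} {ρ} miss miss' with a ≟ᶠ a'
  ... | yes a≡a' = a≡a'
  ... | no a≢a'  = contradiction
                     (≤-viaInjection (↔-sym FinP.*↔×) codes↔ (λ (s , j) → code s j (InCol? j ρ)) code-inj)
                     (2[2+m]≤n⇒2n≰n+2m m'' n 2m≤n)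
    where
    row : Fin 2 → Fin (2 + m'')
    row zero       = a
    row (suc zero) = a'

    row-miss : ∀ s → ¬ InRow (row s) ρ
    row-miss zero       = miss
    row-miss (suc zero) = miss'

    row-inj : Injective _≡_ _≡_ row
    row-inj {zero}     {zero}     _ = refl
    row-inj {zero}     {suc zero} e = contradiction e a≢a'
    row-inj {suc zero} {zero}     e = contradiction (sym e) a≢a'
    row-inj {suc zero} {suc zero} _ = refl

    a≢ : ∀ {i j} → c (i , j) ≡ ρ → a ≢ i
    a≢ {j = j} e refl = miss (j , e)

    a'≢ : ∀ {i j} → c (i , j) ≡ ρ → a' ≢ i
    a'≢ {j = j} e refl = miss' (j , e)

    codes↔ : (Fin n ⊎ (Fin 2 × Fin m'')) ↔ Fin (n + 2 * m'')
    codes↔ = ↔-trans (↔-refl ⊎-↔ ↔-sym FinP.*↔×) (↔-sym FinP.+↔⊎)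

    code : ∀ s j → Dec (InCol j ρ) → Fin n ⊎ (Fin 2 × Fin m'')
    code s j (yes (i , e)) = inj₂ (s , punchOut₂ a≢a' (a≢ e) (a'≢ e))
    code s j (no _)        = inj₁ (punchOut {i = ρ} {j = c (row s , j)} (λ e → row-miss s (j , sym e)))

    near-transfer : ∀ s j s' j' → ¬ InCol j ρ → ∀ x → Near (row s , j) x → Near (row s' , j') x
    near-transfer s j s' j' ρ∉col x near with x ≟ᶠ ρ
    ... | yes refl = contradiction near [ row-miss s , ρ∉col ]
    ... | no x≢ρ   = inj₁ (inRow-unless-missing (row-miss s') x≢ρ)

    code-inj′ : ∀ s j s' j' d d' → code s j d ≡ code s' j' d' → (s , j) ≡ (s' , j')
    code-inj′ s j s' j' (yes (i , e)) (yes (i' , e')) eq with ,-injective (inj₂-injective eq)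
    ... | refl , p≡p' with punchOut₂-injective a≢a' (a≢ e) (a'≢ e) (a≢ e') (a'≢ e') p≡p'
    ...   | refl = cong (s ,_) (row-injective i (trans e (sym e')))
    code-inj′ s j s' j' (no ρ∉col) (no ρ∉col') eq = cong₂ _,_ (row-inj (cong proj₁ same)) (cong proj₂ same)
      where
      same : (row s , j) ≡ (row s' , j')
      same = loc _ _ (FinP.punchOut-injective {i = ρ} _ _ (inj₁-injective eq))
               (near-transfer s j s' j' ρ∉col) (near-transfer s' j' s j ρ∉col')
    code-inj′ _ _ _ _ (yes _) (no _)  ()
    code-inj′ _ _ _ _ (no _)  (yes _) ()

    code-inj : Injective _≡_ _≡_ (λ (s , j) → code s j (InCol? j ρ))
    code-inj {s , j} {s' , j'} = code-inj′ s j s' j' (InCol? j ρ) (InCol? j' ρ)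

  -- For each row a' ≠ a, the vertex of row a below the occurrence of r a in row a' sees every
  -- colour; these m(m − 1) flags have pairwise distinct colours.
  locating⇒M0Cond : NearLocating → 2 * (2 + m'') ≤ n → M0Cond n (2 + m'')
  locating⇒M0Cond loc 2m≤n = ≤-viaInjection (↔-sym FinP.*↔×) ↔-refl (c ∘ flag) flag-inj
    where
    r : Fin (2 + m'') → Fin (suc n)
    r a = proj₁ (missing a)

    r-inj : Injective _≡_ _≡_ r
    r-inj {a} {a'} e = missing-injective loc 2m≤n (proj₂ (missing a)) (subst (λ x → ¬ InRow a' x) (sym e) (proj₂ (missing a')))

    open Missing r (proj₂ ∘ missing) r-inj

    below : ∀ a e → InRow (punchIn a e) (r a)
    below a e = inRow-other (FinP.punchInᵢ≢i a e ∘ sym)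

    flag : Fin (2 + m'') × Fin (suc m'') → Vertex
    flag (a , e) = a , proj₁ (below a e)

    is-flag : ∀ p → Flag (flag p)
    is-flag (a , e) = punchIn a e , proj₂ (below a e)

    flag-inj : Injective _≡_ _≡_ (c ∘ flag)
    flag-inj {a , e} {a' , e'} eq
      with refl , same-col ← ,-injective (nearLocating⇒flags-injective loc (is-flag (a , e)) (is-flag (a' , e')) eq)
      = cong (a ,_) (FinP.punchIn-injective a e e' (col-injective _ (begin
          c (punchIn a e , proj₁ (below a e))   ≡⟨ proj₂ (below a e) ⟩
          r a                                   ≡⟨ proj₂ (below a e') ⟨
          c (punchIn a e' , proj₁ (below a e')) ≡⟨ cong (λ j → c (punchIn a e' , j)) same-col ⟨
          c (punchIn a e' , proj₁ (below a e))  ∎)))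
      where open ≡-Reasoning

spareColour⇒M0Cond : ∀ {m'' n} → 2 * (2 + m'') ≤ n → LocColorable (K (2 + m'') □ K n) (suc n) → M0Cond n (2 + m'')
spareColour⇒M0Cond {m''} {n} 2m≤n (c , proper , onto , loc) = locating⇒M0Cond proper (locating⇒nearLocating loc) 2m≤n
  where open Rook.Colouring.Onto (2 + m'') n (suc n) c onto

locColorable⇒n<colours : ∀ {m'' n'' k} → LocColorable (K (2 + m'') □ K (suc n'')) k → suc n'' < k
locColorable⇒n<colours {m''} {n''} {k} (c , proper , onto , loc) = locating⇒n<colours 0≢1 zero onto loc
  where
  open Rook.Colouring.Proper (2 + m'') (suc n'') k c proper
  0≢1 : zero {suc m''} ≢ suc zero
  0≢1 ()

-- Arithmetic modulo N

*+-injective : ∀ d {a a' r r'} .{{_ : NonZero d}} → r < d → r' < d →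
               a * d + r ≡ a' * d + r' → a ≡ a' × r ≡ r'
*+-injective d {a} {a'} {r} {r'} r<d r'<d e = *-cancelʳ-≡ a a' d (+-cancelʳ-≡ r _ _ (trans e (cong (a' * d +_) (sym r≡r')))) , r≡r'
  where
  rem : ∀ {q s} → s < d → (q * d + s) % d ≡ s
  rem {q} {s} s<d = trans (cong (_% d) (+-comm (q * d) s)) (trans ([m+kn]%n≡m%n s q d) (m<n⇒m%n≡m s<d))
  r≡r' : r ≡ r'
  r≡r' = trans (sym (rem {a} r<d)) (trans (cong (_% d) e) (rem {a'} r'<d))

*2≢suc-*2 : ∀ p q → q * 2 ≢ suc (p * 2)
*2≢suc-*2 p q e = 0≢1+n (proj₂ (*+-injective 2 {q} {p} (s≤s z≤n) (s≤s (s≤s z≤n))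
  (trans (+-identityʳ (q * 2)) (trans e (+-comm 1 (p * 2))))))

-- y mod N, for y < 2N.
wrap : ℕ → ℕ → ℕ
wrap N y with y <? N
... | yes _ = y
... | no _  = y ∸ N

wrap-cases : ∀ N y → (y < N × wrap N y ≡ y) ⊎ (N ≤ y × wrap N y + N ≡ y)
wrap-cases N y with y <? N
... | yes y<N = inj₁ (y<N , refl)
... | no y≮N  = inj₂ (≮⇒≥ y≮N , m∸n+n≡m (≮⇒≥ y≮N))

wrap-< : ∀ N y → y < N + N → wrap N y < N
wrap-< N y y<2N with wrap-cases N y
... | inj₁ (y<N , w≡y) = subst (_< N) (sym w≡y) y<N
... | inj₂ (_ , w+N≡y) = +-cancelʳ-< _ _ N (subst (_< N + N) (sym w+N≡y) y<2N)

wrap-small : ∀ {N y} → y < N → wrap N y ≡ y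
wrap-small {N} {y} y<N with wrap-cases N y
... | inj₁ (_ , w≡y)   = w≡y
... | inj₂ (N≤y , _)   = contradiction N≤y (<⇒≱ y<N)

wrap-+N : ∀ {N x} → x < N → wrap N (x + N) ≡ x
wrap-+N {N} {x} x<N with wrap-cases N (x + N)
... | inj₁ (x+N<N , _)   = contradiction x+N<N (≤⇒≯ (m≤n+m N x))
... | inj₂ (_ , w+N≡x+N) = +-cancelʳ-≡ N _ _ w+N≡x+N

wrap-injective : ∀ N lo {y y'} → lo ≤ y → lo ≤ y' → y < lo + N → y' < lo + N → wrap N y ≡ wrap N y' → y ≡ y'
wrap-injective N lo {y} {y'} lo≤y lo≤y' y<lo+N y'<lo+N e with wrap-cases N y | wrap-cases N y'
... | inj₁ (_ , w≡y) | inj₁ (_ , w'≡y') = trans (sym w≡y) (trans e w'≡y')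
... | inj₂ (_ , w+N≡y) | inj₂ (_ , w'+N≡y') = trans (sym w+N≡y) (trans (cong (_+ N) e) w'+N≡y')
... | inj₁ (_ , w≡y) | inj₂ (_ , w'+N≡y') = contradiction y'<lo+N (≤⇒≯ (begin
  lo + N  ≤⟨ +-monoˡ-≤ N lo≤y ⟩
  y + N   ≡⟨ cong (_+ N) (trans (sym w≡y) e) ⟩
  _ + N   ≡⟨ w'+N≡y' ⟩
  y'      ∎))
  where open ≤-Reasoning
... | inj₂ (_ , w+N≡y) | inj₁ (_ , w'≡y') = contradiction y<lo+N (≤⇒≯ (begin
  lo + N  ≤⟨ +-monoˡ-≤ N lo≤y' ⟩
  y' + N  ≡⟨ cong (_+ N) (trans (sym w'≡y') (sym e)) ⟩
  _ + N   ≡⟨ w+N≡y ⟩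
  y       ∎))
  where open ≤-Reasoning

wrap-≡-suc : ∀ N y y' → wrap N y' ≡ suc (wrap N y) → y' ≡ suc y ⊎ y' ≡ suc y + N ⊎ y' + N ≡ suc y
wrap-≡-suc N y y' e with wrap-cases N y | wrap-cases N y'
... | inj₁ (_ , w≡y) | inj₁ (_ , w'≡y') = inj₁ (trans (sym w'≡y') (trans e (cong suc w≡y)))
... | inj₂ (_ , w+N≡y) | inj₂ (_ , w'+N≡y') = inj₁ (trans (sym w'+N≡y') (trans (cong (_+ N) e) (cong suc w+N≡y)))
... | inj₁ (_ , w≡y) | inj₂ (_ , w'+N≡y') = inj₂ (inj₁ (trans (sym w'+N≡y') (cong (_+ N) (trans e (cong suc w≡y)))))
... | inj₂ (_ , w+N≡y) | inj₁ (_ , w'≡y') = inj₂ (inj₂ (trans (cong (_+ N) (trans (sym w'≡y') e)) (cong suc w+N≡y)))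

wrap-even-not-consecutive : ∀ n s p q → p * 2 < n → q * 2 < n →
                            wrap (2 + n) (q * 2 + s) ≢ suc (wrap (2 + n) (p * 2 + s))
wrap-even-not-consecutive n s p q 2p<n 2q<n e with wrap-≡-suc (2 + n) _ _ e
... | inj₁ y'≡1+y = *2≢suc-*2 p q (+-cancelʳ-≡ s _ _ y'≡1+y)
... | inj₂ (inj₁ y'≡1+y+N) = <⇒≱ 2q<n (begin
  n                 ≤⟨ m≤n+m n (3 + p * 2) ⟩
  (3 + p * 2) + n   ≡⟨ +-cancelʳ-≡ s _ _ (trans (shuffle (p * 2) s n) (sym y'≡1+y+N)) ⟩
  q * 2             ∎)
  where open ≤-Reasoning
        shuffle : ∀ x s n → (3 + x) + n + s ≡ suc (x + s) + (2 + n)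
        shuffle = solve-∀
... | inj₂ (inj₂ y'+N≡1+y) = <⇒≱ 2p<n (begin
  n                   ≤⟨ m≤n+m n (suc (q * 2)) ⟩
  suc (q * 2 + n)     ≡⟨ +-cancelʳ-≡ s _ _ (suc-injective (trans (shuffle (q * 2) s n) y'+N≡1+y)) ⟩
  p * 2               ∎)
  where open ≤-Reasoning
        shuffle : ∀ x s n → suc (suc (x + n) + s) ≡ x + s + (2 + n)
        shuffle = solve-∀

shift : ℕ → ℕ → ℕ → ℕ
shift Q k t = wrap Q (t + (Q ∸ k))

shift-< : ∀ Q k t → t < Q → shift Q k t < Q
shift-< Q k t t<Q = wrap-< Q _ (+-mono-<-≤ t<Q (m∸n≤m Q k))

shift-injectiveʳ : ∀ Q k {t t'} → t < Q → t' < Q → shift Q k t ≡ shift Q k t' → t ≡ t'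
shift-injectiveʳ Q k {t} {t'} t<Q t'<Q e =
  +-cancelʳ-≡ (Q ∸ k) _ _ (wrap-injective Q (Q ∸ k) (m≤n+m _ t) (m≤n+m _ t') (window t<Q) (window t'<Q) e)
  where
  window : ∀ {t} → t < Q → t + (Q ∸ k) < (Q ∸ k) + Q
  window {t} t<Q = subst (_< (Q ∸ k) + Q) (+-comm (Q ∸ k) t) (+-monoʳ-< (Q ∸ k) t<Q)

shift-injectiveˡ : ∀ Q {k k'} t → k < Q → k' < Q → shift Q k t ≡ shift Q k' t → k ≡ k'
shift-injectiveˡ Q {k} {k'} t k<Q k'<Q e =
  ∸-cancelˡ-≡ (<⇒≤ k<Q) (<⇒≤ k'<Q) (+-cancelˡ-≡ t _ _
    (wrap-injective Q (suc t) (lower k<Q) (lower k'<Q) (upper k) (upper k') e))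
  where
  lower : ∀ {k} → k < Q → suc t ≤ t + (Q ∸ k)
  lower {k} k<Q = subst (_≤ t + (Q ∸ k)) (+-comm t 1) (+-monoʳ-≤ t (m<n⇒0<n∸m k<Q))
  upper : ∀ k → t + (Q ∸ k) < suc t + Q
  upper k = s≤s (+-monoʳ-≤ t (m∸n≤m Q k))

shift-≡-∸ : ∀ {Q k t} → k ≤ t → t < Q → shift Q k t ≡ t ∸ k
shift-≡-∸ {Q} {k} {t} k≤t t<Q = trans (cong (wrap Q) t+[Q∸k]≡[t∸k]+Q) (wrap-+N (≤-<-trans (m∸n≤m t k) t<Q))
  where
  t+[Q∸k]≡[t∸k]+Q : t + (Q ∸ k) ≡ (t ∸ k) + Q
  t+[Q∸k]≡[t∸k]+Q = begin
    t + (Q ∸ k)            ≡⟨ cong (_+ (Q ∸ k)) (m∸n+n≡m k≤t) ⟨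
    (t ∸ k) + k + (Q ∸ k)  ≡⟨ +-assoc (t ∸ k) k (Q ∸ k) ⟩
    (t ∸ k) + (k + (Q ∸ k)) ≡⟨ cong ((t ∸ k) +_) (m+[n∸m]≡n (≤-trans k≤t (<⇒≤ t<Q))) ⟩
    (t ∸ k) + Q            ∎
    where open ≡-Reasoning

cyclic : ℕ → ℕ → ℕ → ℕ
cyclic M k e = wrap M (k + suc e)

cyclic-< : ∀ {M k e} → k < M → suc e < M → cyclic M k e < M
cyclic-< {M} k<M e<M = wrap-< M _ (+-mono-< k<M e<M)

cyclic-≢ : ∀ {M k e} → k < M → suc e < M → cyclic M k e ≢ k
cyclic-≢ {M} {k} {e} k<M e<M eq = 1+n≢0 (+-cancelˡ-≡ k _ _ (trans k+1+e≡k (sym (+-identityʳ k))))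
  where
  k+1+e≡k : k + suc e ≡ k
  k+1+e≡k = wrap-injective M k (m≤m+n k _) ≤-refl (+-monoʳ-< k e<M) (m<m+n k (<-≤-trans (s≤s z≤n) e<M))
              (trans eq (sym (wrap-small k<M)))

cyclic-injectiveˡ : ∀ {M k k' e} → k < M → k' < M → suc e < M → cyclic M k e ≡ cyclic M k' e → k ≡ k'
cyclic-injectiveˡ {M} {k} {k'} {e} k<M k'<M _ eq =
  +-cancelʳ-≡ (suc e) _ _ (wrap-injective M (suc e) (m≤n+m _ k) (m≤n+m _ k') (window k<M) (window k'<M) eq)
  where
  window : ∀ {k} → k < M → k + suc e < suc e + M
  window {k} k<M = subst (_< suc e + M) (+-comm (suc e) k) (+-monoʳ-< (suc e) k<M)

cyclic-injectiveʳ : ∀ {M k e e'} → suc e < M → suc e' < M → cyclic M k e ≡ cyclic M k e' → e ≡ e'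
cyclic-injectiveʳ {M} {k} e<M e'<M eq =
  suc-injective (+-cancelˡ-≡ k _ _ (wrap-injective M k (m≤m+n k _) (m≤m+n k _) (+-monoʳ-< k e<M) (+-monoʳ-< k e'<M) eq))

-- The colouring for (b)

module TwoSpareColours {m n : ℕ} (c : Fin m × Fin n → Fin (suc (suc n)))
                       (proper : IsProperColoring (K m □ K n) (suc (suc n)) c) where
  open Rook m n
  open Colouring (suc (suc n)) c
  open Proper proper

  inRow-unless-missing₂ : ∀ {a x y w} → x ≢ y → ¬ InRow a x → ¬ InRow a y → x ≢ w → y ≢ w → InRow a w
  inRow-unless-missing₂ {a} {x} {y} {w} x≢y miss-x miss-y x≢w y≢w with InRow? a w
  ... | yes in-w  = in-w
  ... | no miss-w = contradiction (<-viaInjectionAvoiding shifted shifted-inj (punchOut₂ x≢y x≢w y≢w) avoids) (<-irrefl refl)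
    where
    x≢ : ∀ j → x ≢ c (a , j)
    x≢ j e = miss-x (j , sym e)
    y≢ : ∀ j → y ≢ c (a , j)
    y≢ j e = miss-y (j , sym e)
    shifted : Fin n → Fin n
    shifted j = punchOut₂ x≢y (x≢ j) (y≢ j)
    shifted-inj : Injective _≡_ _≡_ shifted
    shifted-inj {j} {j'} e = row-injective a (punchOut₂-injective x≢y (x≢ j) (y≢ j) (x≢ j') (y≢ j') e)
    avoids : ∀ j → shifted j ≢ punchOut₂ x≢y x≢w y≢w
    avoids j e = miss-w (j , punchOut₂-injective x≢y (x≢ j) (y≢ j) x≢w y≢w e)

module SkewColouring {m n : ℕ} (2m≤n : 2 * m ≤ n) where
  open Rook m n

  N : ℕ
  N = 2 + n

  2+2a≤n : (a : Fin m) → 2 + toℕ a * 2 ≤ n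
  2+2a≤n a = ≤-trans (*-monoˡ-≤ 2 (FinP.toℕ<n a)) (≤-trans (≤-reflexive (*-comm m 2)) 2m≤n)

  2a<n : (a : Fin m) → toℕ a * 2 < n
  2a<n a = ≤-trans (s≤s (m≤n+m _ 1)) (2+2a≤n a)

  n<N : n < N
  n<N = m<n+m n (s≤s z≤n)

  2a<N : (a : Fin m) → toℕ a * 2 < N
  2a<N a = <-trans (2a<n a) n<N

  b+2<N : (b : Fin n) → suc (suc (toℕ b)) < N
  b+2<N b = s≤s (s≤s (FinP.toℕ<n b))

  -- Row a holds the colours 2a + 2, …, 2a + n + 1 mod n + 2, so it misses exactly 2a and 2a + 1.
  value : Fin m → Fin n → ℕ
  value a b = toℕ a * 2 + suc (suc (toℕ b))

  colour : Vertex → Fin N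
  colour (a , b) = fromℕ< (wrap-< N _ (+-mono-< (2a<N a) (b+2<N b)))

  toℕ-colour : ∀ a b → toℕ (colour (a , b)) ≡ wrap N (value a b)
  toℕ-colour a b = FinP.toℕ-fromℕ< _

  colour-≡ : ∀ a b a' b' → colour (a , b) ≡ colour (a' , b') → wrap N (value a b) ≡ wrap N (value a' b')
  colour-≡ a b a' b' e = trans (sym (toℕ-colour a b)) (trans (cong toℕ e) (toℕ-colour a' b'))

  proper : IsProperColoring G N colour
  proper (a , b) (_ , b') (inj₁ (refl , b≢b')) e =
    b≢b' (FinP.toℕ-injective (suc-injective (suc-injective (+-cancelˡ-≡ (toℕ a * 2) _ _
      (wrap-injective N (toℕ a * 2) (m≤m+n _ _) (m≤m+n _ _)
        (+-monoʳ-< (toℕ a * 2) (b+2<N b)) (+-monoʳ-< (toℕ a * 2) (b+2<N b')) (colour-≡ a b a b' e))))))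
  proper (a , b) (a' , _) (inj₂ (a≢a' , refl)) e =
    a≢a' (FinP.toℕ-injective (*-cancelʳ-≡ _ _ 2 (+-cancelʳ-≡ (suc (suc (toℕ b))) _ _
      (wrap-injective N (suc (suc (toℕ b))) (m≤n+m _ _) (m≤n+m _ _) (window a) (window a') (colour-≡ a b a' b e)))))
    where
    window : ∀ a → value a b < suc (suc (toℕ b)) + N
    window a = subst (_< suc (suc (toℕ b)) + N) (+-comm (suc (suc (toℕ b))) (toℕ a * 2))
                 (+-monoʳ-< (suc (suc (toℕ b))) (2a<N a))

  open Colouring N colour
  open TwoSpareColours colour proper

  missingColour : Fin m → Fin 2 → Fin N
  missingColour a i = fromℕ< {toℕ a * 2 + toℕ i} (begin-strict
    toℕ a * 2 + toℕ i  <⟨ +-monoʳ-< (toℕ a * 2) (FinP.toℕ<n i) ⟩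
    toℕ a * 2 + 2      ≡⟨ +-comm (toℕ a * 2) 2 ⟩
    2 + toℕ a * 2      ≤⟨ 2+2a≤n a ⟩
    n                  <⟨ n<N ⟩
    N                  ∎)
    where open ≤-Reasoning

  toℕ-missingColour : ∀ a i → toℕ (missingColour a i) ≡ toℕ a * 2 + toℕ i
  toℕ-missingColour a i = FinP.toℕ-fromℕ< _

  missingColour-injective : ∀ {a i a' i'} → missingColour a i ≡ missingColour a' i' → a ≡ a' × i ≡ i'
  missingColour-injective {a} {i} {a'} {i'} e with *+-injective 2 (FinP.toℕ<n i) (FinP.toℕ<n i')
    (trans (sym (toℕ-missingColour a i)) (trans (cong toℕ e) (toℕ-missingColour a' i')))
  ... | a≡a' , i≡i' = FinP.toℕ-injective a≡a' , FinP.toℕ-injective i≡i'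

  row-misses : ∀ a i → ¬ InRow a (missingColour a i)
  row-misses a i (b , e)
    with wrap-cases N (value a b) | trans (sym (toℕ-colour a b)) (trans (cong toℕ e) (toℕ-missingColour a i))
  ... | inj₁ (_ , w≡v) | w≡2a+i = <⇒≱ (FinP.toℕ<n i)
          (≤-trans (s≤s (s≤s z≤n)) (≤-reflexive (+-cancelˡ-≡ (toℕ a * 2) _ _ (trans (sym w≡v) w≡2a+i))))
  ... | inj₂ (_ , w+N≡v) | w≡2a+i = <⇒≱ (FinP.toℕ<n b) (begin
    n          ≤⟨ m≤n+m n (toℕ i) ⟩
    toℕ i + n  ≡⟨ suc-injective (suc-injective (+-cancelˡ-≡ (toℕ a * 2) _ _ eq)) ⟩
    toℕ b      ∎)
    where
    open ≤-Reasoning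
    shuffle : ∀ x i n → x + suc (suc (i + n)) ≡ x + i + (2 + n)
    shuffle = solve-∀
    eq : toℕ a * 2 + suc (suc (toℕ i + n)) ≡ toℕ a * 2 + suc (suc (toℕ b))
    eq = trans (shuffle (toℕ a * 2) (toℕ i) n) (trans (cong (_+ N) (sym w≡2a+i)) w+N≡v)

  missingColour-pair-≢ : ∀ a → missingColour a zero ≢ missingColour a (suc zero)
  missingColour-pair-≢ a e = 0≢1+n (cong toℕ (proj₂ (missingColour-injective {a} {zero} {a} {suc zero} e)))

  missingColour-rows-≢ : ∀ {a a'} i i' → a ≢ a' → missingColour a i ≢ missingColour a' i'
  missingColour-rows-≢ {a} {a'} i i' a≢a' e = a≢a' (proj₁ (missingColour-injective {a} {i} {a'} {i'} e))

  inRow-unless-missing : ∀ {a x} → missingColour a zero ≢ x → missingColour a (suc zero) ≢ x → InRow a x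
  inRow-unless-missing {a} = inRow-unless-missing₂ {a} (missingColour-pair-≢ a) (row-misses a zero) (row-misses a (suc zero))

  inRow-other : ∀ {a a'} i → a ≢ a' → InRow a (missingColour a' i)
  inRow-other {a} i a≢a' = inRow-unless-missing {a} (missingColour-rows-≢ zero i a≢a') (missingColour-rows-≢ (suc zero) i a≢a')

  column-misses-a-pair : ∀ {a b} → InCol b (missingColour a zero) → InCol b (missingColour a (suc zero)) → ⊥
  column-misses-a-pair {a} {b} (K , e) (K' , e') =
    wrap-even-not-consecutive n (suc (suc (toℕ b))) (toℕ K) (toℕ K') (2a<n K) (2a<n K') (begin
      wrap N (value K' b)       ≡⟨ toℕ-colour K' b ⟨
      toℕ (colour (K' , b))     ≡⟨ cong toℕ e' ⟩
      toℕ (missingColour a (suc zero)) ≡⟨ toℕ-missingColour a (suc zero) ⟩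
      toℕ a * 2 + 1             ≡⟨ +-suc (toℕ a * 2) 0 ⟩
      suc (toℕ a * 2 + 0)       ≡⟨ cong suc (toℕ-missingColour a zero) ⟨
      suc (toℕ (missingColour a zero)) ≡⟨ cong (suc ∘ toℕ) e ⟨
      suc (toℕ (colour (K , b)))  ≡⟨ cong suc (toℕ-colour K b) ⟩
      suc (wrap N (value K b))  ∎)
    where open ≡-Reasoning

  onto : {a₀ a₁ : Fin m} → a₀ ≢ a₁ → IsOnto G N colour
  onto {a₀} {a₁} a₀≢a₁ x with FinP.any? (λ i → missingColour a₀ i ≟ᶠ x)
  ... | yes (i , refl) = let (j , e) = inRow-other {a₁} i (a₀≢a₁ ∘ sym) in (a₁ , j) , e
  ... | no ¬missing    = let (j , e) = inRow-unless-missing {a₀} (λ e → ¬missing (zero , e)) (λ e → ¬missing (suc zero , e))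
                         in (a₀ , j) , e

  -- Two vertices in different rows a, a' cannot see the same colours: the colours 2a', 2a' + 1
  -- missing from row a' occur in row a, but cannot both occur in one column.
  nearLocating : NearLocating
  nearLocating (a , b) (a' , b') cu≡cv u⇒v _ with a ≟ᶠ a'
  ... | yes refl = cong (a ,_) (Proper.row-injective proper a cu≡cv)
  ... | no a≢a'  = ⊥-elim (column-misses-a-pair {a'} {b'} (inCol zero) (inCol (suc zero)))
    where
    inCol : ∀ i → InCol b' (missingColour a' i)
    inCol i = [ (λ inRow → contradiction inRow (row-misses a' i)) , id ] (u⇒v _ (inj₁ (inRow-other {a} i a≢a')))

  locColorable : {a₀ a₁ : Fin m} → a₀ ≢ a₁ → LocColorable G N
  locColorable a₀≢a₁ = colour , proper , onto a₀≢a₁ , Onto.nearLocating⇒locating (onto a₀≢a₁) nearLocating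

-- The colouring for (a)

toℕ-punchOut-< : ∀ {n} {a k : Fin (suc n)} (a≢k : a ≢ k) → toℕ k < toℕ a → toℕ (punchOut a≢k) ≡ toℕ k
toℕ-punchOut-< {_}     {zero}  {zero}  a≢k _ = contradiction refl a≢k
toℕ-punchOut-< {suc _} {suc a} {zero}  _   _ = refl
toℕ-punchOut-< {suc _} {suc a} {suc k} a≢k (s≤s k<a) = cong suc (toℕ-punchOut-< (a≢k ∘ cong suc) k<a)

toℕ-punchOut-> : ∀ {n} {a k : Fin (suc n)} (a≢k : a ≢ k) → toℕ a < toℕ k → suc (toℕ (punchOut a≢k)) ≡ toℕ k
toℕ-punchOut-> {_}     {zero}  {suc k} _   _ = refl
toℕ-punchOut-> {suc _} {suc a} {suc k} a≢k (s≤s a<k) = cong suc (toℕ-punchOut-> (a≢k ∘ cong suc) a<k)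

module FlagColouring {m'' Q : ℕ} (M*M≤Q : (2 + m'') * (2 + m'') ≤ Q) where

  M m' : ℕ
  M  = 2 + m''
  m' = suc m''

  -- Block a of the main columns, at the place of k among the rows other than a.
  slot : (k a : Fin M) → a ≢ k → ℕ
  slot k a a≢k = toℕ a * M + suc (toℕ (punchOut a≢k))

  slot-< : ∀ {k a} (a≢k : a ≢ k) → slot k a a≢k < Q
  slot-< {k} {a} a≢k = <-≤-trans (begin-strict
    toℕ a * M + suc (toℕ (punchOut a≢k))  <⟨ +-monoʳ-< (toℕ a * M) (s≤s (FinP.toℕ<n (punchOut a≢k))) ⟩
    toℕ a * M + M                         ≡⟨ +-comm (toℕ a * M) M ⟩
    suc (toℕ a) * M                       ≤⟨ *-monoˡ-≤ M (FinP.toℕ<n a) ⟩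
    M * M                                 ∎) M*M≤Q
    where open ≤-Reasoning

  slot-irrelevant : ∀ {k a} (p p' : a ≢ k) → slot k a p ≡ slot k a p'
  slot-irrelevant {a = a} p p' = cong (λ i → toℕ a * M + suc (toℕ i)) (FinP.punchOut-cong a refl)

  slot-injective : ∀ {k a k' a'} (p : a ≢ k) (p' : a' ≢ k') → slot k a p ≡ slot k' a' p' → a ≡ a' × k ≡ k'
  slot-injective {k} {a} {k'} {a'} p p' e with *+-injective M (s≤s (FinP.toℕ<n (punchOut p))) (s≤s (FinP.toℕ<n (punchOut p'))) e
  ... | a≡a' , po≡po' with FinP.toℕ-injective {i = a} {j = a'} a≡a'
  ...   | refl = refl , FinP.punchOut-injective p p' (FinP.toℕ-injective (suc-injective po≡po'))

  flag-value : ∀ {k a} (p : a ≢ k) → shift Q (toℕ a) (slot k a p) ≡ suc (toℕ a * m' + toℕ (punchOut p))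
  flag-value {k} {a} p = trans (shift-≡-∸ a≤slot (slot-< p)) (begin
    toℕ a * suc m' + suc po ∸ toℕ a     ≡⟨ cong (λ x → x + suc po ∸ toℕ a) (*-suc (toℕ a) m') ⟩
    toℕ a + toℕ a * m' + suc po ∸ toℕ a ≡⟨ cong (_∸ toℕ a) (+-assoc (toℕ a) (toℕ a * m') (suc po)) ⟩
    toℕ a + (toℕ a * m' + suc po) ∸ toℕ a ≡⟨ m+n∸m≡n (toℕ a) _ ⟩
    toℕ a * m' + suc po                 ≡⟨ +-suc (toℕ a * m') po ⟩
    suc (toℕ a * m' + po)               ∎)
    where
    open ≡-Reasoning
    po : ℕ
    po = toℕ (punchOut p)
    a≤slot : toℕ a ≤ slot k a p
    a≤slot = ≤-trans (m≤m*n (toℕ a) M) (m≤m+n _ _)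

  flag-value-injective : ∀ {k a k' a'} (p : a ≢ k) (p' : a' ≢ k') →
                             shift Q (toℕ a) (slot k a p) ≡ shift Q (toℕ a') (slot k' a' p') → a ≡ a'
  flag-value-injective p p' e = FinP.toℕ-injective (proj₁ (*+-injective m'
    (FinP.toℕ<n (punchOut p)) (FinP.toℕ<n (punchOut p'))
    (suc-injective (trans (sym (flag-value p)) (trans e (flag-value p'))))))

  displaced-value : ∀ {k a} (p : a ≢ k) → ∃ λ r → r < 2 × shift Q (toℕ k) (slot k a p) ≡ toℕ a * M + r
  displaced-value {k} {a} p with <-cmp (toℕ k) (toℕ a)
  ... | tri≈ _ k≡a _ = contradiction (FinP.toℕ-injective (sym k≡a)) p
  ... | tri< k<a _ _ = 1 , s≤s (s≤s z≤n) , trans (shift-≡-∸ k≤slot (slot-< p)) (begin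
    toℕ a * M + suc po ∸ toℕ k    ≡⟨ cong (λ x → toℕ a * M + suc x ∸ toℕ k) (toℕ-punchOut-< p k<a) ⟩
    toℕ a * M + suc (toℕ k) ∸ toℕ k ≡⟨ cong (_∸ toℕ k) (+-assoc (toℕ a * M) 1 (toℕ k)) ⟨
    toℕ a * M + 1 + toℕ k ∸ toℕ k   ≡⟨ m+n∸n≡m _ (toℕ k) ⟩
    toℕ a * M + 1                   ∎)
    where
    open ≡-Reasoning
    po : ℕ
    po = toℕ (punchOut p)
    k≤slot : toℕ k ≤ slot k a p
    k≤slot = ≤-trans (n≤1+n (toℕ k)) (subst (_≤ slot k a p) (cong suc (toℕ-punchOut-< p k<a)) (m≤n+m _ _))
  ... | tri> _ _ a<k = 0 , s≤s z≤n , trans (shift-≡-∸ k≤slot (slot-< p)) (begin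
    toℕ a * M + suc po ∸ toℕ k    ≡⟨ cong (λ x → toℕ a * M + x ∸ toℕ k) (toℕ-punchOut-> p a<k) ⟩
    toℕ a * M + toℕ k ∸ toℕ k     ≡⟨ m+n∸n≡m _ (toℕ k) ⟩
    toℕ a * M                     ≡⟨ +-identityʳ _ ⟨
    toℕ a * M + 0                 ∎)
    where
    open ≡-Reasoning
    po : ℕ
    po = toℕ (punchOut p)
    k≤slot : toℕ k ≤ slot k a p
    k≤slot = subst (_≤ slot k a p) (toℕ-punchOut-> p a<k) (m≤n+m _ _)

  displaced-value-injective : ∀ {k a k' a'} (p : a ≢ k) (p' : a' ≢ k') →
                             shift Q (toℕ k) (slot k a p) ≡ shift Q (toℕ k') (slot k' a' p') → a ≡ a'
  displaced-value-injective p p' e with displaced-value p | displaced-value p'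
  ... | r , r<2 , eq | r' , r'<2 , eq' = FinP.toℕ-injective (proj₁ (*+-injective M
          (≤-trans r<2 (s≤s (s≤s z≤n))) (≤-trans r'<2 (s≤s (s≤s z≤n))) (trans (sym eq) (trans e eq'))))

  opaque
    partner : Fin M → Fin m' → Fin M
    partner k e = fromℕ< (cyclic-< (FinP.toℕ<n k) (s≤s (FinP.toℕ<n e)))

    toℕ-partner : ∀ k e → toℕ (partner k e) ≡ cyclic M (toℕ k) (toℕ e)
    toℕ-partner k e = FinP.toℕ-fromℕ< _

  partner-≢ : ∀ k e → partner k e ≢ k
  partner-≢ k e eq = cyclic-≢ {M} {toℕ k} {toℕ e} (FinP.toℕ<n k) (s≤s (FinP.toℕ<n e))
    (trans (sym (toℕ-partner k e)) (cong toℕ eq))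

  partner-injectiveˡ : ∀ {k k'} e → partner k e ≡ partner k' e → k ≡ k'
  partner-injectiveˡ {k} {k'} e eq = FinP.toℕ-injective (cyclic-injectiveˡ {M} {toℕ k} {toℕ k'} {toℕ e}
    (FinP.toℕ<n k) (FinP.toℕ<n k') (s≤s (FinP.toℕ<n e))
    (trans (sym (toℕ-partner k e)) (trans (cong toℕ eq) (toℕ-partner k' e))))

  partner-injectiveʳ : ∀ k {e e'} → partner k e ≡ partner k e' → e ≡ e'
  partner-injectiveʳ k {e} {e'} eq = FinP.toℕ-injective (cyclic-injectiveʳ {M} {toℕ k} {toℕ e} {toℕ e'}
    (s≤s (FinP.toℕ<n e)) (s≤s (FinP.toℕ<n e'))
    (trans (sym (toℕ-partner k e)) (trans (cong toℕ eq) (toℕ-partner k e'))))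

  opaque
    ordinary : Fin M → (t : ℕ) → t < Q → Fin Q
    ordinary k t t<Q = fromℕ< (shift-< Q (toℕ k) t t<Q)

    toℕ-ordinary : ∀ k t (lt : t < Q) → toℕ (ordinary k t lt) ≡ shift Q (toℕ k) t
    toℕ-ordinary k t lt = FinP.toℕ-fromℕ< _

  ordinary-≡ : ∀ {k t k' t'} {lt : t < Q} {lt' : t' < Q} → ordinary k t lt ≡ ordinary k' t' lt' →
               shift Q (toℕ k) t ≡ shift Q (toℕ k') t'
  ordinary-≡ {k} {t} {k'} {t'} {lt} {lt'} e = trans (sym (toℕ-ordinary k t lt)) (trans (cong toℕ e) (toℕ-ordinary k' t' lt'))

  Special : Fin M → Fin Q → Set
  Special k t = ∃ λ a → Σ (a ≢ k) λ a≢k → slot k a a≢k ≡ toℕ t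

  special? : ∀ k t → Dec (Special k t)
  special? k t = FinP.any? special-at?
    where
    special-at? : ∀ a → Dec (Σ (a ≢ k) λ a≢k → slot k a a≢k ≡ toℕ t)
    special-at? a with a ≟ᶠ k
    ... | yes a≡k = no λ (a≢k , _) → a≢k a≡k
    ... | no a≢k with slot k a a≢k ≟ toℕ t
    ...   | yes e = yes (a≢k , e)
    ...   | no ≢t = no λ (p , e) → ≢t (trans (slot-irrelevant a≢k p) e)

  -- A special colour for each row and Q ordinary colours; m' spare columns e and Q main columns t.
  -- Row k has the ordinary colour t − k in main column t, except that it carries each special colour
  -- a ≠ k, in column slot k a; the ordinary colour displaced from there goes to the spare column e
  -- with partner k e = a.
  Colour Column : Set
  Colour = Fin M ⊎ Fin Q
  Column = Fin m' ⊎ Fin Q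

  entryAt : ∀ k t → Dec (Special k t) → Colour
  entryAt k t (yes (a , _)) = inj₁ a
  entryAt k t (no _)        = inj₂ (ordinary k (toℕ t) (FinP.toℕ<n t))

  entry : Fin M → Column → Colour
  entry k (inj₁ e) = inj₂ (ordinary k (slot k (partner k e) (partner-≢ k e)) (slot-< (partner-≢ k e)))
  entry k (inj₂ t) = entryAt k t (special? k t)

  colour : Fin M × Fin (m' + Q) → Fin (M + Q)
  colour (k , b) = join M Q (entry k (splitAt m' b))

  entryAt-inj₁ : ∀ {k t a} d → entryAt k t d ≡ inj₁ a → Σ (a ≢ k) λ a≢k → slot k a a≢k ≡ toℕ t
  entryAt-inj₁ (yes (_ , a≢k , e)) refl = a≢k , e

  entry-inj₁ : ∀ k s {a} → entry k s ≡ inj₁ a → ∃ λ t → s ≡ inj₂ t × Σ (a ≢ k) λ a≢k → slot k a a≢k ≡ toℕ t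
  entry-inj₁ k (inj₂ t) eq = t , refl , entryAt-inj₁ (special? k t) eq

  entryAt-injective : ∀ k {t t'} d d' → entryAt k t d ≡ entryAt k t' d' → t ≡ t'
  entryAt-injective k (yes (a , p , e)) (yes (_ , p' , e')) eq with inj₁-injective eq
  ... | refl = FinP.toℕ-injective (trans (sym e) (trans (slot-irrelevant p p') e'))
  entryAt-injective k {t} {t'} (no _) (no _) eq =
    FinP.toℕ-injective (shift-injectiveʳ Q (toℕ k) (FinP.toℕ<n t) (FinP.toℕ<n t') (ordinary-≡ (inj₂-injective eq)))

  entry-injective : ∀ k {s s'} → entry k s ≡ entry k s' → s ≡ s'
  entry-injective k {inj₁ e} {inj₁ e'} eq = cong inj₁ (partner-injectiveʳ k (proj₁ (slot-injective (partner-≢ k e) (partner-≢ k e')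
    (shift-injectiveʳ Q (toℕ k) (slot-< (partner-≢ k e)) (slot-< (partner-≢ k e')) (ordinary-≡ (inj₂-injective eq))))))
  entry-injective k {inj₁ e} {inj₂ t} eq with special? k t
  ... | no ¬special = contradiction (partner k e , partner-≢ k e ,
          shift-injectiveʳ Q (toℕ k) (slot-< (partner-≢ k e)) (FinP.toℕ<n t) (ordinary-≡ (inj₂-injective eq))) ¬special
  entry-injective k {inj₂ t} {inj₁ e} eq = sym (entry-injective k {inj₁ e} {inj₂ t} (sym eq))
  entry-injective k {inj₂ t} {inj₂ t'} eq = cong inj₂ (entryAt-injective k (special? k t) (special? k t') eq)

  k<Q : (k : Fin M) → toℕ k < Q
  k<Q k = <-≤-trans (FinP.toℕ<n k) (≤-trans (m≤m*n M M) M*M≤Q)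

  entryAt-injectiveˡ : ∀ {k k' t} d d' → entryAt k t d ≡ entryAt k' t d' → k ≡ k'
  entryAt-injectiveˡ (yes (a , p , e)) (yes (_ , p' , e')) eq with inj₁-injective eq
  ... | refl = proj₂ (slot-injective p p' (trans e (sym e')))
  entryAt-injectiveˡ {k} {k'} {t} (no _) (no _) eq =
    FinP.toℕ-injective (shift-injectiveˡ Q (toℕ t) (k<Q k) (k<Q k') (ordinary-≡ (inj₂-injective eq)))

  entry-injectiveˡ : ∀ {k k'} s → entry k s ≡ entry k' s → k ≡ k'
  entry-injectiveˡ (inj₁ e) eq = partner-injectiveˡ e
    (displaced-value-injective (partner-≢ _ e) (partner-≢ _ e) (ordinary-≡ (inj₂-injective eq)))
  entry-injectiveˡ {k} {k'} (inj₂ t) eq = entryAt-injectiveˡ (special? k t) (special? k' t) eq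

  entry-flag : ∀ {k a t} (a≢k : a ≢ k) → slot k a a≢k ≡ toℕ t →
               entry a (inj₂ t) ≡ inj₂ (ordinary a (toℕ t) (FinP.toℕ<n t))
  entry-flag {k} {a} {t} a≢k e with special? a t
  ... | no _ = refl
  ... | yes (_ , a''≢a , e'') = contradiction (sym (proj₂ (slot-injective a≢k a''≢a (trans e (sym e''))))) a≢k

  join-injective : ∀ {x y : Colour} → join M Q x ≡ join M Q y → x ≡ y
  join-injective {x} {y} e = trans (sym (FinP.splitAt-join M Q x)) (trans (cong (splitAt M) e) (FinP.splitAt-join M Q y))

  splitAt-injective : ∀ {b b' : Fin (m' + Q)} → splitAt m' b ≡ splitAt m' b' → b ≡ b'
  splitAt-injective {b} {b'} e = trans (sym (FinP.join-splitAt m' Q b)) (trans (cong (join m' Q) e) (FinP.join-splitAt m' Q b'))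

  open Rook M (m' + Q)
  open Colouring (M + Q) colour

  proper : IsProperColoring G (M + Q) colour
  proper (k , b) (_ , b') (inj₁ (refl , b≢b')) eq = b≢b' (splitAt-injective (entry-injective k (join-injective eq)))
  proper (k , b) (k' , _) (inj₂ (k≢k' , refl)) eq = k≢k' (entry-injectiveˡ (splitAt m' b) (join-injective eq))

  special : Fin M → Fin (M + Q)
  special a = join M Q (inj₁ a)

  special-missing : ∀ a → ¬ InRow a (special a)
  special-missing a (b , eq) with entry-inj₁ a (splitAt m' b) (join-injective eq)
  ... | _ , _ , a≢a , _ = a≢a refl

  open OneSpareColour colour proper
  open Missing special special-missing (inj₁-injective ∘ join-injective)

  flag-entry : ∀ {a b} → Flag (a , b) →
               ∃ λ k → Σ (a ≢ k) λ a≢k → ∃ λ x → entry a (splitAt m' b) ≡ inj₂ x × toℕ x ≡ shift Q (toℕ a) (slot k a a≢k)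
  flag-entry {a} {b} (k , eq) with entry-inj₁ k (splitAt m' b) (join-injective eq)
  ... | t , sb≡t , a≢k , slot≡t = k , a≢k , _ , trans (cong (entry a) sb≡t) (entry-flag a≢k slot≡t) ,
                                  trans (toℕ-ordinary a (toℕ t) _) (cong (shift Q (toℕ a)) (sym slot≡t))

  flags-injective : ∀ {a b a' b'} → Flag (a , b) → Flag (a' , b') → colour (a , b) ≡ colour (a' , b') → a ≡ a'
  flags-injective {a} {b} {a'} {b'} flag flag' eq with flag-entry {a} {b} flag | flag-entry {a'} {b'} flag'
  ... | k , a≢k , x , entry≡x , x≡ | k' , a'≢k' , x' , entry≡x' , x'≡ =
    flag-value-injective a≢k a'≢k' (trans (sym x≡) (trans (cong toℕ x≡x') x'≡))
    where
    x≡x' : x ≡ x'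
    x≡x' = inj₂-injective (trans (sym entry≡x) (trans (join-injective eq) entry≡x'))

  locColorable : LocColorable G (M + Q)
  locColorable = colour , proper , onto 0≢1 ,
    Onto.nearLocating⇒locating (onto 0≢1) (flags-injective⇒nearLocating λ {a} {b} {a'} {b'} → flags-injective {a} {b} {a'} {b'})
    where
    0≢1 : zero ≢ suc zero
    0≢1 ()

m0-square : ∀ {m' Q m0} → M0Cond (m' + Q) m0 → suc m' + 1 ≤ m0 → suc m' * suc m' ≤ Q
m0-square {m'} {Q} {m0} m0-cond M+1≤m0 = +-cancelˡ-≤ (suc m') _ _ (begin
  suc (suc m') * suc m' ≤⟨ *-mono-≤ M+1≤m0′ (∸-monoˡ-≤ 1 M+1≤m0′) ⟩
  m0 * (m0 ∸ 1)         ≤⟨ m0-cond ⟩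
  suc (m' + Q)          ∎)
  where
  open ≤-Reasoning
  M+1≤m0′ : suc (suc m') ≤ m0
  M+1≤m0′ = subst (_≤ m0) (+-comm (suc m') 1) M+1≤m0

locColorable-n+1 : ∀ {m'' n m0} → suc m'' ≤ n → M0Cond n m0 → 2 + m'' + 1 ≤ m0 → LocColorable (K (2 + m'') □ K n) (suc n)
locColorable-n+1 {m''} {n} m'≤n m0-cond M+1≤m0 with n ∸ suc m'' | m+[n∸m]≡n m'≤n
... | Q | refl = FlagColouring.locColorable (m0-square m0-cond M+1≤m0)

theorem3 : (m n : ℕ) → 2 ≤ m → 3 ≤ n → m ≤ n → (m0 : ℕ) → IsM0 n m0 →
    ((m + 1 ≤ m0 → χL≡ (K m □ K n) (n + 1)) ×
     (m0 + 1 ≤ m → 2 * m ≤ n → χL≡ (K m □ K n) (n + 2)))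
theorem3 (suc (suc m'')) n@(suc _) (s≤s (s≤s _)) _ m≤n m0 (m0-cond , m0-max) = part-a , part-b
  where
  M : ℕ
  M = 2 + m''

  part-a : M + 1 ≤ m0 → χL≡ (K M □ K n) (n + 1)
  part-a M+1≤m0 = subst (LocColorable _) (+-comm 1 n) (locColorable-n+1 (≤-trans (n≤1+n _) m≤n) m0-cond M+1≤m0)
                , λ k L → subst (_≤ k) (+-comm 1 n) (locColorable⇒n<colours L)

  -- With n + 1 colours, 2m ≤ n would force m ≤ m0.
  part-b : m0 + 1 ≤ M → 2 * M ≤ n → χL≡ (K M □ K n) (n + 2)
  part-b m0+1≤M 2M≤n = subst (LocColorable _) (+-comm 2 n) (SkewColouring.locColorable 2M≤n 0≢1) , n+2≤colours
    where
    0≢1 : zero {suc m''} ≢ suc zero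
    0≢1 ()
    n+2≤colours : ∀ k → LocColorable (K M □ K n) k → n + 2 ≤ k
    n+2≤colours k L with m≤n⇒m<n∨m≡n (locColorable⇒n<colours L)
    ... | inj₁ n+1<k = subst (_≤ k) (+-comm 2 n) n+1<k
    ... | inj₂ refl  = contradiction (m0-max M (spareColour⇒M0Cond 2M≤n L)) (<⇒≱ (subst (_≤ M) (+-comm m0 1) m0+1≤M))
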